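{- No multi-orientable three-dimensional GFT graph contains a tadface, i.e. a face that passes at least twice through the same edge.
   Context: A three-dimensional (orientable) GFT graph is a graph with 4-valent vertices in which every edge consists of three parallel strands (left, middle, right), joined without twists. At each vertex the four half-edges are cyclically ordered, and strands are joined inside the vertex following the Boulatov vertex $\phi(g_1,g_2,g_3)\phi(g_3,g_4,g_5)\phi(g_5,g_2,g_6)\phi(g_6,g_4,g_1)$: each pair of distinct half-edges at a vertex shares exactly one strand; the middle strand of a half-edge connects to the cyclically opposite half-edge and the two outer strands connect to the two cyclically adjacent half-edges. The graph may have external legs. A face is a maximal path formed by concatenated strands (closed, or ending at external legs). A tadface is a face going at least twice through an edge (through two different strands of that edge). A GFT graph is multi-orientable if each half-edge can be labeled $+$ or $-$ so that at every vertex there are two $+$ and two $-$ half-edges alternating in the cyclic order ($+,-,+,-$), and every edge joins a $-$ half-edge to a $+$ half-edge. -}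

module Defs where

open import Data.Nat using (ℕ)
open import Data.Fin using (Fin; zero; suc)
open import Data.Product using (_×_; _,_; Σ; ∃; ∃-syntax)
open import Data.Maybe using (Maybe; just)
open import Data.Bool using (Bool)
open import Relation.Binary.PropositionalEquality using (_≡_; _≢_)
open import Relation.Binary.Construct.Closure.ReflexiveTransitive using (Star)

next : Fin 4 → Fin 4
next zero = suc zero
next (suc zero) = suc (suc zero)
next (suc (suc zero)) = suc (suc (suc zero))
next (suc (suc (suc zero))) = zero

prev : Fin 4 → Fin 4
prev zero = suc (suc (suc zero))
prev (suc zero) = zero
prev (suc (suc zero)) = suc zero
prev (suc (suc (suc zero))) = suc (suc zero)

opp : Fin 4 → Fin 4
opp i = next (next i)

-- The three strands of a half-edge, as seen looking outward from its vertex.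
data Strand : Set where
  left middle right : Strand

-- Across an untwisted edge, the left strand seen from one end is the right
-- strand seen from the other end; the middle strand stays middle.
flipS : Strand → Strand
flipS left = right
flipS middle = middle
flipS right = left

-- Edges are given by a symmetric, irreflexive
-- partial pairing of half-edges; unpaired half-edges are external legs.
record GFTGraph : Set where
  field
    nV : ℕ
    partner : Fin nV × Fin 4 → Maybe (Fin nV × Fin 4)
    partner-sym : ∀ h h' → partner h ≡ just h' → partner h' ≡ just h
    partner-irrefl : ∀ h → partner h ≢ just h

module _ (G : GFTGraph) where
  open GFTGraph G

  HalfEdge : Set
  HalfEdge = Fin nV × Fin 4

  StrandOcc : Set
  StrandOcc = HalfEdge × Strand

  -- Strand connection inside a vertex (Boulatov vertex): the left strand of
  -- half-edge i joins the right strand of i+1, the middle strand of i joins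
  -- the middle strand of i+2.
  vlink : StrandOcc → StrandOcc
  vlink ((v , i) , left) = ((v , next i) , right)
  vlink ((v , i) , middle) = ((v , opp i) , middle)
  vlink ((v , i) , right) = ((v , prev i) , left)

  data Adj : StrandOcc → StrandOcc → Set where
    vtx : ∀ s → Adj s (vlink s)
    edg : ∀ h h' p → partner h ≡ just h' → Adj (h , p) (h' , flipS p)

  -- Two strand occurrences lie on the same face (faces = connected
  -- components of the strand-connection graph).
  SameFace : StrandOcc → StrandOcc → Set
  SameFace = Star Adj

  HasTadface : Set
  HasTadface = Σ HalfEdge λ h → Σ HalfEdge λ h' → Σ Strand λ p → Σ Strand λ q →
    partner h ≡ just h' × p ≢ q × SameFace (h , p) (h , q)

  -- Multi-orientability: signs (true = + , false = -) alternating around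
  -- each vertex, and each edge joins a + and a - half-edge.
  MultiOrientable : Set
  MultiOrientable = Σ (HalfEdge → Bool) λ σ →
    (∀ v i → σ (v , next i) ≢ σ (v , i)) ×
    (∀ h h' → partner h ≡ just h' → σ h ≢ σ h')

module Submission where

-- A multi-orientation σ lets us read every strand occurrence in a
-- fixed frame: at a +-half-edge keep the strand's name, at a −-half-edge
-- swap left and right.  Call the result the colour of the occurrence.
--   * Along an edge, the strand names are swapped (flipS) and the two ends
--     have opposite signs, so the colour is unchanged.
--   * Inside a vertex, the left strand of half-edge i meets the right strand
--     of i+1 (and symmetrically); adjacent half-edges carry opposite signs,
--     so again the colour is unchanged.  Middle strands are always middle.
-- Hence the colour is constant on every face.  A tadface would contain two
-- different strands p ≠ q of one half-edge h, whose colours orient (σ h) p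
-- and orient (σ h) q differ because orient (σ h) is a bijection.

open import Defs
open import Relation.Nullary using (¬_)
open import Data.Bool using (Bool; true; false)
open import Data.Fin using (zero; suc)
open import Data.Product using (_,_)
open import Data.Maybe using (just)
open import Data.Empty using (⊥-elim)
open import Relation.Binary.Core using (Rel)
open import Relation.Binary.PropositionalEquality
  using (_≡_; _≢_; refl; sym; trans; cong)
open import Relation.Binary.Construct.Closure.ReflexiveTransitive
  using (Star; gfold)

orient : Bool → Strand → Strand
orient true  p = p
orient false p = flipS p

flipS-involutive : ∀ p → flipS (flipS p) ≡ p
flipS-involutive left   = refl
flipS-involutive middle = refl
flipS-involutive right  = refl

orient-involutive : ∀ b p → orient b (orient b p) ≡ p
orient-involutive true  p = refl
orient-involutive false p = flipS-involutive p

orient-injective : ∀ b {p q} → orient b p ≡ orient b q → p ≡ q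
orient-injective b {p} {q} e =
  trans (sym (orient-involutive b p))
        (trans (cong (orient b) e) (orient-involutive b q))

orient-middle : ∀ b → orient b middle ≡ middle
orient-middle true  = refl
orient-middle false = refl

orient-opposite : ∀ {b b'} p → b ≢ b' → orient b p ≡ orient b' (flipS p)
orient-opposite {true}  {true}  p b≢b' = ⊥-elim (b≢b' refl)
orient-opposite {false} {false} p b≢b' = ⊥-elim (b≢b' refl)
orient-opposite {true}  {false} p _    = sym (flipS-involutive p)
orient-opposite {false} {true}  p _    = refl

next-prev : ∀ i → next (prev i) ≡ i
next-prev zero                   = refl
next-prev (suc zero)             = refl
next-prev (suc (suc zero))       = refl
next-prev (suc (suc (suc zero))) = refl

star-invariant : ∀ {a b r} {A : Set a} {B : Set b} {R : Rel A r}
  (f : A → B) → (∀ {x y} → R x y → f x ≡ f y) →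
  ∀ {x y} → Star R x y → f x ≡ f y
star-invariant f step = gfold f _≡_ (λ r e → trans (step r) e) refl

module Colouring (G : GFTGraph) (σ : HalfEdge G → Bool)
  (alternating : ∀ v i → σ (v , next i) ≢ σ (v , i))
  (edges-flip  : ∀ h h' → GFTGraph.partner G h ≡ just h' → σ h ≢ σ h')
  where

  colour : StrandOcc G → Strand
  colour (h , p) = orient (σ h) p

  colour-step : ∀ {s t} → Adj G s t → colour s ≡ colour t
  colour-step (vtx ((v , i) , left)) =
    orient-opposite left (λ e → alternating v i (sym e))
  colour-step (vtx ((v , i) , middle)) =
    trans (orient-middle (σ (v , i))) (sym (orient-middle (σ (v , opp i))))
  colour-step (vtx ((v , i) , right)) =
    orient-opposite right (λ e → alternating v (prev i) (prev-sign-flip e))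
    where
    prev-sign-flip : σ (v , i) ≡ σ (v , prev i) → σ (v , next (prev i)) ≡ σ (v , prev i)
    prev-sign-flip = trans (cong (λ j → σ (v , j)) (next-prev i))
  colour-step (edg h h' p e) = orient-opposite p (edges-flip h h' e)

  colour-face : ∀ {s t} → SameFace G s t → colour s ≡ colour t
  colour-face = star-invariant colour colour-step

theorem3p1 : (G : GFTGraph) → MultiOrientable G → ¬ HasTadface G
theorem3p1 G (σ , alternating , edges-flip) (h , _ , p , q , _ , p≢q , face) =
  p≢q (orient-injective (σ h) (colour-face face))
  where open Colouring G σ alternating edges-flip
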